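{- Let $p$ be a prime. There is exactly one numerical semigroup $S$ of genus $g(S)=p+1$ that is both symmetric and reflective. It is $S=\langle A\rangle$ where $A=\{2,7\}$ if $p=2$, and $A=\{p\}\cup\{p+2,p+3,\dots,2p-1\}$ if $p$ is odd.
   Context: A numerical semigroup is a submonoid $S$ of $(\mathbb{N}_0,+)$ with finite complement; $g(S)=\#(\mathbb{N}_0\setminus S)$ and $F(S)$ is the largest element of $\mathbb{N}_0\setminus S$. $\langle A\rangle$ is the set of finite $\mathbb{N}_0$-linear combinations of elements of $A$. $S$ is symmetric if for all $z\in\mathbb{Z}$ exactly one of $z$ and $F(S)-z$ is in $S$. $S$ (with $g=g(S)\ge1$) is reflective if for every integer $z$ with $0\le z\le g-1$ exactly one of $z$ and $z+g$ lies in $S$. -}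

module Defs where

open import Data.Nat using (ℕ; zero; suc; _+_; _*_; _∸_; _≤_; _<_; _≟_)
open import Data.Integer as ℤ using (ℤ; +_)
open import Data.List using (List; []; _∷_; length; map; upTo; zipWith)
open import Data.Nat.ListAction using (sum)
open import Data.Empty using (⊥)
open import Data.List.Membership.Propositional using (_∈_)
open import Data.List.Relation.Unary.Unique.Propositional using (Unique)
open import Data.Vec using (Vec; toList)
open import Data.Product using (Σ; Σ-syntax; ∃; _×_; _,_)
open import Data.Sum using (_⊎_)
open import Relation.Nullary using (¬_; yes; no)
open import Relation.Binary.PropositionalEquality using (_≡_)
open import Function.Bundles using (_⇔_)

record NumericalSemigroup : Set₁ where
  field
    _∈S       : ℕ → Set
    zero∈     : 0 ∈S
    +-closed  : ∀ {m n} → m ∈S → n ∈S → (m + n) ∈S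
    cofinite  : Σ[ N ∈ ℕ ] (∀ n → N ≤ n → n ∈S)

open NumericalSemigroup public

_∈Sℤ_ : ℤ → NumericalSemigroup → Set
(+ n)        ∈Sℤ S = _∈S S n
(ℤ.-[1+ _ ]) ∈Sℤ S = ⊥

ExactlyOne : Set → Set → Set
ExactlyOne P Q = (P × ¬ Q) ⊎ (¬ P × Q)

HasGenus : NumericalSemigroup → ℕ → Set
HasGenus S k = Σ[ L ∈ List ℕ ] (length L ≡ k × Unique L × (∀ n → (n ∈ L) ⇔ (¬ _∈S S n)))

IsFrobenius : NumericalSemigroup → ℕ → Set
IsFrobenius S f = ¬ _∈S S f × (∀ n → f < n → _∈S S n)

Symmetric : NumericalSemigroup → Set
Symmetric S = Σ[ f ∈ ℕ ] (IsFrobenius S f ×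
  (∀ (z : ℤ) → ExactlyOne (z ∈Sℤ S) (((+ f) ℤ.- z) ∈Sℤ S)))

Reflective : NumericalSemigroup → Set
Reflective S = Σ[ g ∈ ℕ ] (HasGenus S g × 1 ≤ g ×
  (∀ z → z < g → ExactlyOne (_∈S S z) (_∈S S (z + g))))

_∈⟨_⟩ : ℕ → List ℕ → Set
n ∈⟨ A ⟩ = Σ[ c ∈ Vec ℕ (length A) ] (sum (zipWith _*_ (toList c) A) ≡ n)

gens : ℕ → List ℕ
gens p with p ≟ 2
... | yes _ = 2 ∷ 7 ∷ []
... | no  _ = p ∷ map (λ i → p + 2 + i) (upTo (p ∸ 2))

{-# OPTIONS --safe #-}
-- Let S be symmetric and reflective of genus g = p + 1, with Frobenius number F.
-- Reflectivity exhibits g distinct gaps below 2g; since S has only g gaps, F < 2g.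
-- Symmetry pairs every gap x with the element F - x, so S has at most ⌈F/2⌉ gaps
-- and 2g ≤ F + 1. Hence F = 2p + 1. Now for z ≤ p, z ∈ S forces z + p + 1 ∉ S and
-- then, by symmetry, p - z ∈ S; so S ∩ [0, p] contains p and is closed under
-- differences. Euclid's algorithm on p and any element 0 < a < p of S would then put
-- gcd (a , p) = 1 into S, hence p + 1 ∈ S, which reflectivity at z = 0 forbids.
-- So 1, …, p - 1 are gaps, reflectivity turns [p + 2, 2p] into elements, and
-- S = {0, p} ∪ [p + 2, 2p] ∪ [2p + 2, ∞). This set is indeed a symmetric, reflective
-- numerical semigroup of genus p + 1, and it is generated by the listed A.

module Submission where

open import Defs
open import Data.Nat
open import Data.Nat.Properties
open import Algebra.Properties.CommutativeSemigroup +-commutativeSemigroup using (interchange)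
open import Data.Nat.DivMod using (_/_; _%_; m%n≡m∸m/n*n; m/n*n≤m; m%n<n)
open import Data.Nat.Divisibility using (m%n≡0⇒n∣m)
open import Data.Nat.Induction using (<-rec)
open import Data.Nat.ListAction using (sum)
open import Data.Nat.Primality using (Prime; prime⇒irreducible; prime⇒nonTrivial)
open import Data.Nat.Tactic.RingSolver using (solve-∀)
open import Data.Integer as ℤ using (-[1+_])
import Data.Integer.Properties as ℤ
open import Data.List using (List; []; _∷_; length; map; upTo; _++_; filter; zipWith)
open import Data.List.Properties using (filter-notAll; length-++; length-map; length-upTo)
open import Data.List.Membership.Propositional using (_∈_)
open import Data.List.Membership.Propositional.Properties
  using (∈-filter⁺; ∈-map⁺; ∈-map⁻; ∈-upTo⁺; ∈-upTo⁻; ∈-++⁺ˡ; ∈-++⁺ʳ; ∈-++⁻)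
open import Data.List.Membership.DecPropositional _≟_ using (_∈?_)
open import Data.List.Relation.Binary.Subset.Propositional using (_⊆_)
open import Data.List.Relation.Unary.Any as Any using (here; there)
open import Data.List.Relation.Unary.All as All using (All; []; _∷_)
import Data.List.Relation.Unary.All.Properties as All
open import Data.List.Relation.Unary.AllPairs using ([]; _∷_)
open import Data.List.Relation.Unary.Unique.Propositional using (Unique)
import Data.List.Relation.Unary.Unique.Propositional.Properties as Unique
open import Data.Vec as Vec using (Vec; []; _∷_; toList)
open import Data.Product using (Σ-syntax; _×_; _,_; proj₁; proj₂; uncurry)
open import Data.Sum using (_⊎_; inj₁; inj₂)
open import Function using (_∘_; id)
open import Function.Bundles using (_⇔_; mk⇔; Equivalence)
import Function.Properties.Equivalence as ⇔
open import Relation.Nullary using (¬_; ¬?; yes; no; contradiction)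
open import Relation.Binary.PropositionalEquality
open import Relation.Binary.Definitions using (tri<; tri≈; tri>)

open Equivalence using (to; from)

-- Counting with duplicate-free lists

_without_ : List ℕ → ℕ → List ℕ
ys without x = filter (λ y → ¬? (y ≟ x)) ys

length-without< : ∀ {x ys} → x ∈ ys → length (ys without x) < length ys
length-without< {x} {ys} x∈ys =
  filter-notAll (λ y → ¬? (y ≟ x)) ys (Any.map (λ x≡y y≢x → y≢x (sym x≡y)) x∈ys)

∈-without⁺ : ∀ {x y ys} → y ∈ ys → y ≢ x → y ∈ ys without x
∈-without⁺ = ∈-filter⁺ (λ y → ¬? (y ≟ _))

length-mono-⊆ : ∀ {xs ys} → Unique xs → xs ⊆ ys → length xs ≤ length ys
length-mono-⊆ {[]} _ _ = z≤n
length-mono-⊆ {x ∷ xs} {ys} (x∉xs ∷ unique) x∷xs⊆ys = begin-strict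
  length xs             ≤⟨ length-mono-⊆ unique xs⊆ys-x ⟩
  length (ys without x) <⟨ length-without< (x∷xs⊆ys (here refl)) ⟩
  length ys             ∎
  where
  open ≤-Reasoning
  xs⊆ys-x : xs ⊆ ys without x
  xs⊆ys-x y∈xs = ∈-without⁺ (x∷xs⊆ys (there y∈xs)) (λ y≡x → All.lookup x∉xs y∈xs (sym y≡x))

injection-≤-length : ∀ n (h : ℕ → ℕ) {ys} → (∀ {i} → i < n → h i ∈ ys) →
  (∀ {i j} → i < n → j < n → h i ≡ h j → i ≡ j) → n ≤ length ys
injection-≤-length zero h _ _ = z≤n
injection-≤-length (suc n) h {ys} h∈ys injective = begin-strict
  n                          ≤⟨ injection-≤-length n h h∈ys-without-hn injective′ ⟩
  length (ys without h n)    <⟨ length-without< (h∈ys ≤-refl) ⟩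
  length ys                  ∎
  where
  open ≤-Reasoning
  h∈ys-without-hn : ∀ {i} → i < n → h i ∈ ys without h n
  h∈ys-without-hn i<n = ∈-without⁺ (h∈ys (m≤n⇒m≤1+n i<n))
    (λ hi≡hn → <⇒≢ i<n (injective (m≤n⇒m≤1+n i<n) ≤-refl hi≡hn))
  injective′ : ∀ {i j} → i < n → j < n → h i ≡ h j → i ≡ j
  injective′ i<n j<n = injective (m≤n⇒m≤1+n i<n) (m≤n⇒m≤1+n j<n)

-- Symmetric and reflective numerical semigroups

exactlyOne-irrefl : ∀ {P} → ¬ ExactlyOne P P
exactlyOne-irrefl (inj₁ (p , ¬p)) = ¬p p
exactlyOne-irrefl (inj₂ (¬p , p)) = ¬p p

module _ {P Q : Set} where

  exactlyOne-¬ˡ : ExactlyOne P Q → ¬ P → Q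
  exactlyOne-¬ˡ (inj₁ (p , _)) ¬p = contradiction p ¬p
  exactlyOne-¬ˡ (inj₂ (_ , q)) _  = q

  exactlyOne-¬ʳ : ExactlyOne P Q → ¬ Q → P
  exactlyOne-¬ʳ (inj₁ (p , _)) _  = p
  exactlyOne-¬ʳ (inj₂ (_ , q)) ¬q = contradiction q ¬q

  exactlyOne-¬¬ˡ⇒¬ʳ : ExactlyOne P Q → ¬ ¬ P → ¬ Q
  exactlyOne-¬¬ˡ⇒¬ʳ (inj₁ (_ , ¬q)) _   = ¬q
  exactlyOne-¬¬ˡ⇒¬ʳ (inj₂ (¬p , _)) ¬¬p = contradiction ¬p ¬¬p

SymmetricPairs : NumericalSemigroup → ℕ → Set
SymmetricPairs S f = ∀ n → n ≤ f → ExactlyOne (_∈S S n) (_∈S S (f ∸ n))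

ReflectivePairs : NumericalSemigroup → ℕ → Set
ReflectivePairs S g = ∀ z → z < g → ExactlyOne (_∈S S z) (_∈S S (z + g))

module _ (S : NumericalSemigroup) where

  gap≤frobenius : ∀ {f n} → IsFrobenius S f → ¬ _∈S S n → n ≤ f
  gap≤frobenius {f} {n} (_ , above) n∉S with n ≤? f
  ... | yes n≤f = n≤f
  ... | no  n≰f = contradiction (above n (≰⇒> n≰f)) n∉S

  symmetric⁺ : ∀ {f} → IsFrobenius S f → SymmetricPairs S f → Symmetric S
  symmetric⁺ {f} frob@(f∉S , above) pairs = f , frob , pairsℤ
    where
    pairsℤ : ∀ z → ExactlyOne (z ∈Sℤ S) ((ℤ.+ f ℤ.- z) ∈Sℤ S)
    pairsℤ -[1+ k ] = inj₂ ((λ ()) , above (f + suc k) (m<m+n f z<s))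
    pairsℤ (ℤ.+ n) with n ≤? f
    ... | yes n≤f = subst (λ z → ExactlyOne (_∈S S n) (z ∈Sℤ S))
                      (sym (trans (ℤ.m-n≡m⊖n f n) (ℤ.⊖-≥ n≤f))) (pairs n n≤f)
    ... | no  n≰f = inj₁ (above n (≰⇒> n≰f) , negative∉S)
      where
      negative∉S : ¬ ((ℤ.+ f ℤ.- ℤ.+ n) ∈Sℤ S)
      negative∉S rewrite ℤ.m-n≡m⊖n f n | ℤ.⊖-< (≰⇒> n≰f) with n ∸ f | m<n⇒0<n∸m (≰⇒> n≰f)
      ... | suc _ | _ = λ ()

  symmetric⁻ : (sym : Symmetric S) → IsFrobenius S (proj₁ sym) × SymmetricPairs S (proj₁ sym)
  symmetric⁻ (f , frob , pairsℤ) = frob , pairs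
    where
    pairs : SymmetricPairs S f
    pairs n n≤f = subst (λ z → ExactlyOne (_∈S S n) (z ∈Sℤ S))
                    (trans (ℤ.m-n≡m⊖n f n) (ℤ.⊖-≥ n≤f)) (pairsℤ (ℤ.+ n))

  genus-unique : ∀ {a b} → HasGenus S a → HasGenus S b → a ≡ b
  genus-unique (L , refl , L-unique , L-gaps) (M , refl , M-unique , M-gaps) =
    ≤-antisym (length-mono-⊆ L-unique (λ {n} → from (M-gaps n) ∘ to (L-gaps n)))
              (length-mono-⊆ M-unique (λ {n} → from (L-gaps n) ∘ to (M-gaps n)))

  reflective⁻ : ∀ {g} → HasGenus S g → Reflective S → ReflectivePairs S g
  reflective⁻ genus (g′ , genus′ , _ , pairs) rewrite genus-unique genus genus′ = pairs

m+m<n+n⇒m<n : ∀ {m n} → m + m < n + n → m < n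
m+m<n+n⇒m<n 2m<2n = ≰⇒> (λ n≤m → <⇒≱ 2m<2n (+-mono-≤ n≤m n≤m))

module GapCounting (S : NumericalSemigroup) {L : List ℕ}
                   (L-gaps : ∀ n → (n ∈ L) ⇔ (¬ _∈S S n)) where

  module _ {g : ℕ} (pairs : ReflectivePairs S g) where

    reflectedGap : ℕ → ℕ
    reflectedGap z with z ∈? L
    ... | yes _ = z
    ... | no  _ = z + g

    reflectedGap-gap : ∀ {z} → z < g → ¬ _∈S S (reflectedGap z)
    reflectedGap-gap {z} z<g with z ∈? L
    ... | yes z∈L = to (L-gaps z) z∈L
    ... | no  z∉L = exactlyOne-¬¬ˡ⇒¬ʳ (pairs z z<g) (z∉L ∘ from (L-gaps z))

    reflectedGap< : ∀ {z} → z < g → reflectedGap z < g + g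
    reflectedGap< {z} z<g with z ∈? L
    ... | yes _ = ≤-trans z<g (m≤m+n g g)
    ... | no  _ = +-monoˡ-< g z<g

    reflectedGap-injective : ∀ {z w} → z < g → w < g → reflectedGap z ≡ reflectedGap w → z ≡ w
    reflectedGap-injective {z} {w} z<g w<g eq with z ∈? L | w ∈? L
    ... | yes _ | yes _ = eq
    ... | no  _ | no  _ = +-cancelʳ-≡ g z w eq
    ... | yes _ | no  _ = contradiction (subst (g ≤_) (sym eq) (m≤n+m g w)) (<⇒≱ z<g)
    ... | no  _ | yes _ = contradiction (subst (g ≤_) eq (m≤n+m g z)) (<⇒≱ w<g)

  -- The g reflected gaps are distinct and below 2g; a Frobenius number f ≥ 2g would be one gap too many.
  frobenius<2genus : ∀ {g f} → length L ≡ g → ReflectivePairs S g → IsFrobenius S f → f < g + g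
  frobenius<2genus {g} {f} refl pairs (f∉S , _) with f <? g + g
  ... | yes f<2g = f<2g
  ... | no  f≮2g = contradiction (begin-strict
          g                     ≤⟨ injection-≤-length g (reflectedGap pairs) reflectedGap∈ (reflectedGap-injective pairs) ⟩
          length (L without f)  <⟨ length-without< (from (L-gaps f) f∉S) ⟩
          g                     ∎) (<-irrefl refl)
    where
    open ≤-Reasoning
    reflectedGap∈ : ∀ {z} → z < g → reflectedGap pairs z ∈ L without f
    reflectedGap∈ z<g = ∈-without⁺ (from (L-gaps _) (reflectedGap-gap pairs z<g))
                          (λ eq → f≮2g (subst (_< g + g) eq (reflectedGap< pairs z<g)))

  module _ {f : ℕ} (frob : IsFrobenius S f) (pairs : SymmetricPairs S f) where

    pairedGap : ℕ → ℕ
    pairedGap y with y ∈? L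
    ... | yes _ = y
    ... | no  _ = f ∸ y

    pairedGap-gap : ∀ {y} → y ∈ L → pairedGap y ≡ y
    pairedGap-gap {y} y∈L with y ∈? L
    ... | yes _   = refl
    ... | no  y∉L = contradiction y∈L y∉L

    pairedGap-element : ∀ {y} → ¬ y ∈ L → pairedGap y ≡ f ∸ y
    pairedGap-element {y} y∉L with y ∈? L
    ... | yes y∈L = contradiction y∈L y∉L
    ... | no  _   = refl

    -- A gap x is the paired gap of min (x , f ∸ x), and x + x ≠ f since x and f ∸ x are not both gaps.
    gap∈pairedGaps : ∀ {k} → f ≤ k + k → ∀ {x} → x ∈ L → x ∈ map pairedGap (upTo k)
    gap∈pairedGaps {k} f≤2k {x} x∈L with x + x ≤? f
    ... | yes 2x≤f = subst (_∈ map pairedGap (upTo k)) (pairedGap-gap x∈L)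
                       (∈-map⁺ pairedGap (∈-upTo⁺ (m+m<n+n⇒m<n (≤-trans 2x<f f≤2k))))
      where
      2x<f : x + x < f
      2x<f = ≤∧≢⇒< 2x≤f λ 2x≡f → exactlyOne-irrefl
               (subst (λ y → ExactlyOne (_∈S S x) (_∈S S y))
                      (trans (cong (_∸ x) (sym 2x≡f)) (m+n∸m≡n x x))
                      (pairs x (gap≤frobenius S frob (to (L-gaps x) x∈L))))
    ... | no  2x≰f = subst (_∈ map pairedGap (upTo k)) pairedGap-y≡x
                       (∈-map⁺ pairedGap (∈-upTo⁺ (m+m<n+n⇒m<n (≤-trans 2y<f f≤2k))))
      where
      x≤f : x ≤ f
      x≤f = gap≤frobenius S frob (to (L-gaps x) x∈L)
      y : ℕ
      y = f ∸ x
      y+x≡f : y + x ≡ f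
      y+x≡f = m∸n+n≡m x≤f
      2y<f : y + y < f
      2y<f = subst (y + y <_) y+x≡f (+-monoʳ-< y (+-cancelʳ-< x y x (subst (_< x + x) (sym y+x≡f) (≰⇒> 2x≰f))))
      y∈S : _∈S S y
      y∈S = exactlyOne-¬ʳ (pairs y (m∸n≤m f x))
              (subst (λ z → ¬ _∈S S z) (sym (m∸[m∸n]≡n x≤f)) (to (L-gaps x) x∈L))
      pairedGap-y≡x : pairedGap y ≡ x
      pairedGap-y≡x = trans (pairedGap-element (λ y∈L → to (L-gaps y) y∈L y∈S)) (m∸[m∸n]≡n x≤f)

  genus≤ : ∀ {g f k} → length L ≡ g → Unique L → IsFrobenius S f → SymmetricPairs S f → f ≤ k + k → g ≤ k
  genus≤ {k = k} refl L-unique frob pairs f≤2k = begin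
    length L                               ≤⟨ length-mono-⊆ L-unique (gap∈pairedGaps frob pairs {k} f≤2k) ⟩
    length (map (pairedGap frob pairs) (upTo k)) ≡⟨ trans (length-map _ (upTo k)) (length-upTo k) ⟩
    k                                      ∎
    where open ≤-Reasoning

symmetric-reflective⇒frobenius : ∀ S {p f} → HasGenus S (suc p) → ReflectivePairs S (suc p) →
  IsFrobenius S f → SymmetricPairs S f → f ≡ suc (p + p)
symmetric-reflective⇒frobenius S {p} {f} (L , len , unique , L-gaps) reflective frob symmetric =
  ≤-antisym f≤2p+1 (≰⇒> f≰2p)
  where
  open GapCounting S L-gaps
  f≤2p+1 : f ≤ suc (p + p)
  f≤2p+1 = ≤-pred (subst (f <_) (+-suc (suc p) p) (frobenius<2genus len reflective frob))
  f≰2p : ¬ f ≤ p + p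
  f≰2p f≤2p = <-irrefl refl (genus≤ len unique frob symmetric f≤2p)

1∈⇒all : ∀ S → _∈S S 1 → ∀ n → _∈S S n
1∈⇒all S _  zero    = zero∈ S
1∈⇒all S 1∈ (suc n) = +-closed S 1∈ (1∈⇒all S 1∈ n)

DifferenceClosed : (ℕ → Set) → Set
DifferenceClosed P = ∀ {a b} → a ≤ b → P a → P b → P (b ∸ a)

module _ {P : ℕ → Set} (closed : DifferenceClosed P) where

  ∸*-closed : ∀ {a b} → P a → P b → ∀ k → k * a ≤ b → P (b ∸ k * a)
  ∸*-closed {a} {b} _   Pb zero    _       = Pb
  ∸*-closed {a} {b} Pa Pb (suc k) [k+1]a≤b =
    subst P (trans (∸-+-assoc b (k * a) a) (cong (b ∸_) (+-comm (k * a) a)))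
      (closed (m+n≤o⇒m≤o∸n a [k+1]a≤b) Pa
        (∸*-closed Pa Pb k (≤-trans (m≤n+m (k * a) a) [k+1]a≤b)))

  %-closed : ∀ {a b} .{{_ : NonZero a}} → P a → P b → P (b % a)
  %-closed {a} {b} Pa Pb = subst P (sym (m%n≡m∸m/n*n b a)) (∸*-closed Pa Pb (b / a) (m/n*n≤m b a))

  -- Euclid's algorithm on p and a stays inside P and ends at gcd (a , p) = 1.
  prime⇒1∈ : ∀ {p} → Prime p → P p → ∀ {a} → 0 < a → a < p → P a → P 1
  prime⇒1∈ {p} p-prime Pp = <-rec (λ a → 0 < a → a < p → P a → P 1) euclid _
    where
    euclid : ∀ a → (∀ {b} → b < a → 0 < b → b < p → P b → P 1) → 0 < a → a < p → P a → P 1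
    euclid a@(suc _) smaller _ a<p Pa with p % a ≟ 0
    ... | yes p%a≡0 with prime⇒irreducible p-prime (m%n≡0⇒n∣m p a p%a≡0)
    ...   | inj₁ a≡1 = subst P a≡1 Pa
    ...   | inj₂ a≡p = contradiction a≡p (<⇒≢ a<p)
    euclid a@(suc _) smaller _ a<p Pa | no p%a≢0 =
      smaller (m%n<n p a) (n≢0⇒n>0 p%a≢0) (<-trans (m%n<n p a) a<p) (%-closed Pa Pp)

-- Submonoids of ℕ and their generators

record IsSubmonoid (P : ℕ → Set) : Set where
  field
    ε∈       : P 0
    ∙-closed : ∀ {m n} → P m → P n → P (m + n)

  *-closed : ∀ {a} k → P a → P (k * a)
  *-closed zero    _  = ε∈
  *-closed (suc k) Pa = ∙-closed Pa (*-closed k Pa)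

combination : (A : List ℕ) → Vec ℕ (length A) → ℕ
combination A c = sum (zipWith _*_ (toList c) A)

combination-zeros : ∀ A → combination A (Vec.replicate _ 0) ≡ 0
combination-zeros []      = refl
combination-zeros (_ ∷ A) = combination-zeros A

combination-+ : ∀ A c d → combination A (Vec.zipWith _+_ c d) ≡ combination A c + combination A d
combination-+ []      []      []      = refl
combination-+ (a ∷ A) (x ∷ c) (y ∷ d) = begin
  (x + y) * a + combination A (Vec.zipWith _+_ c d)         ≡⟨ cong₂ _+_ (*-distribʳ-+ a x y) (combination-+ A c d) ⟩
  (x * a + y * a) + (combination A c + combination A d)     ≡⟨ interchange (x * a) (y * a) _ _ ⟩
  (x * a + combination A c) + (y * a + combination A d)     ∎
  where open ≡-Reasoning

⟨⟩-isSubmonoid : ∀ A → IsSubmonoid (_∈⟨ A ⟩)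
⟨⟩-isSubmonoid A = record
  { ε∈       = Vec.replicate _ 0 , combination-zeros A
  ; ∙-closed = λ { (c , refl) (d , refl) → Vec.zipWith _+_ c d , combination-+ A c d }
  }

generator∈⟨⟩ : ∀ {a A} → a ∈ A → a ∈⟨ A ⟩
generator∈⟨⟩ {a} {_ ∷ A} (here refl) =
  1 ∷ Vec.replicate _ 0 , trans (cong₂ _+_ (+-identityʳ a) (combination-zeros A)) (+-identityʳ a)
generator∈⟨⟩ (there a∈A) with c , eq ← generator∈⟨⟩ a∈A = 0 ∷ c , eq

⟨⟩-least : ∀ {P A} → IsSubmonoid P → All P A → ∀ {n} → n ∈⟨ A ⟩ → P n
⟨⟩-least {P} {A} submonoid PA (c , refl) = least A PA c
  where
  open IsSubmonoid submonoid
  least : ∀ A → All P A → (c : Vec ℕ (length A)) → P (combination A c)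
  least []      []         []      = ε∈
  least (a ∷ A) (Pa ∷ PA) (x ∷ c) = ∙-closed (*-closed x Pa) (least A PA c)

module _ {P : ℕ → Set} (submonoid : IsSubmonoid P) where
  open IsSubmonoid submonoid

  -- Adding a to the run m, …, m + a - 1 produces the next run.
  run⇒all≥ : ∀ {a m} → 0 < a → P a → (∀ k → k < a → P (m + k)) → ∀ k → P (m + k)
  run⇒all≥ {a} {m} 0<a Pa run = <-rec (λ k → P (m + k)) step
    where
    step : ∀ k → (∀ {j} → j < k → P (m + j)) → P (m + k)
    step k smaller with k <? a
    ... | yes k<a = run k k<a
    ... | no  k≮a = subst P m+[k∸a]+a≡m+k (∙-closed (smaller (∸-monoʳ-< 0<a (≮⇒≥ k≮a))) Pa)
      where
      m+[k∸a]+a≡m+k : m + (k ∸ a) + a ≡ m + k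
      m+[k∸a]+a≡m+k = trans (+-assoc m (k ∸ a) a) (cong (m +_) (m∸n+n≡m (≮⇒≥ k≮a)))

-- The semigroup {0, p} ∪ [p + 2, 2p] ∪ [2p + 2, ∞)

data Sₚ (p : ℕ) : ℕ → Set where
  0∈      : Sₚ p 0
  p∈      : Sₚ p p
  middle∈ : ∀ {n} → 2 + p ≤ n → n ≤ p + p → Sₚ p n
  above∈  : ∀ {n} → 2 + (p + p) ≤ n → Sₚ p n

data Region (p : ℕ) : ℕ → Set where
  at-0   : Region p 0
  low    : ∀ {n} → 0 < n → n < p → Region p n
  at-p   : Region p p
  at-1+p : Region p (suc p)
  mid    : ∀ {n} → 2 + p ≤ n → n ≤ p + p → Region p n
  at-F   : Region p (suc (p + p))
  high   : ∀ {n} → 2 + (p + p) ≤ n → Region p n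

region : ∀ p n → Region p n
region p zero = at-0
region p n@(suc _) with <-cmp n p
... | tri< n<p _ _  = low z<s n<p
... | tri≈ _ refl _ = at-p
... | tri> _ _ p<n with n ≟ suc p
...   | yes refl    = at-1+p
...   | no n≢1+p with n ≤? p + p
...     | yes n≤2p  = mid (≤∧≢⇒< p<n (n≢1+p ∘ sym)) n≤2p
...     | no n≰2p with n ≟ suc (p + p)
...       | yes refl = at-F
...       | no n≢F   = high (≤∧≢⇒< (≰⇒> n≰2p) (n≢F ∘ sym))

2+2p≤⇒2+p≤ : ∀ {p n} → 2 + (p + p) ≤ n → 2 + p ≤ n
2+2p≤⇒2+p≤ {p} = ≤-trans (+-monoʳ-≤ 2 (m≤m+n p p))

low∉Sₚ : ∀ {p n} → 0 < n → n < p → ¬ Sₚ p n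
low∉Sₚ ()  _   0∈
low∉Sₚ _   n<p p∈ = <-irrefl refl n<p
low∉Sₚ {p} _ n<p (middle∈ 2+p≤n _) = <⇒≱ n<p (≤-trans (m≤n+m p 2) 2+p≤n)
low∉Sₚ {p} _ n<p (above∈ 2+2p≤n) = <⇒≱ n<p (≤-trans (m≤n+m p 2) (2+2p≤⇒2+p≤ 2+2p≤n))

1+p∉Sₚ : ∀ {p} → ¬ Sₚ p (suc p)
1+p∉Sₚ (middle∈ 2+p≤1+p _) = <-irrefl refl 2+p≤1+p
1+p∉Sₚ (above∈ 2+2p≤1+p) = <-irrefl refl (2+2p≤⇒2+p≤ 2+2p≤1+p)

F∉Sₚ : ∀ {p} → ¬ Sₚ p (suc (p + p))
F∉Sₚ F∈ = ≢F F∈ refl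
  where
  ≢F : ∀ {p n} → Sₚ p n → n ≢ suc (p + p)
  ≢F 0∈                 ()
  ≢F {p} p∈             p≡F  = <-irrefl p≡F (s≤s (m≤m+n p p))
  ≢F (middle∈ _ n≤2p)   refl = <-irrefl refl n≤2p
  ≢F (above∈ 2+2p≤n)    refl = <-irrefl refl 2+2p≤n

Sₚ⇒≡0⊎p≤ : ∀ {p n} → Sₚ p n → n ≡ 0 ⊎ p ≤ n
Sₚ⇒≡0⊎p≤ 0∈                    = inj₁ refl
Sₚ⇒≡0⊎p≤ p∈                    = inj₂ ≤-refl
Sₚ⇒≡0⊎p≤ {p} (middle∈ 2+p≤n _) = inj₂ (≤-trans (m≤n+m p 2) 2+p≤n)
Sₚ⇒≡0⊎p≤ {p} (above∈ 2+2p≤n)   = inj₂ (≤-trans (m≤n+m p 2) (2+2p≤⇒2+p≤ 2+2p≤n))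

Sₚ-+-closed-large : ∀ {p a b} → 2 + p ≤ a → Sₚ p a → Sₚ p b → Sₚ p (a + b)
Sₚ-+-closed-large 2+p≤a a∈ b∈ with Sₚ⇒≡0⊎p≤ b∈
... | inj₁ refl = subst (Sₚ _) (sym (+-identityʳ _)) a∈
... | inj₂ p≤b  = above∈ (+-mono-≤ 2+p≤a p≤b)

Sₚ-+-closed : ∀ {p a b} → 2 ≤ p → Sₚ p a → Sₚ p b → Sₚ p (a + b)
Sₚ-+-closed _       0∈               b∈                = b∈
Sₚ-+-closed _       a∈@(middle∈ l _) b∈                = Sₚ-+-closed-large l a∈ b∈
Sₚ-+-closed _       a∈@(above∈ l)    b∈                = Sₚ-+-closed-large (2+2p≤⇒2+p≤ l) a∈ b∈
Sₚ-+-closed _       p∈               0∈                = subst (Sₚ _) (sym (+-identityʳ _)) p∈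
Sₚ-+-closed 2≤p     p∈               p∈                = middle∈ (+-monoˡ-≤ _ 2≤p) ≤-refl
Sₚ-+-closed {p} _   p∈               b∈@(middle∈ l _)  = subst (Sₚ p) (+-comm _ p) (Sₚ-+-closed-large l b∈ p∈)
Sₚ-+-closed {p} _   p∈               b∈@(above∈ l)     = subst (Sₚ p) (+-comm _ p) (Sₚ-+-closed-large (2+2p≤⇒2+p≤ l) b∈ p∈)

low-complement : ∀ {p n m} → 0 < n → n < p → n + m ≡ suc (p + p) → 2 + p ≤ m × m ≤ p + p
low-complement {p} {n} {m} 0<n n<p n+m≡F = +-cancelˡ-≤ n _ _ n+[2+p]≤n+m , ≤-pred 1+m≤F
  where
  open ≤-Reasoning
  n+[2+p]≤n+m : n + (2 + p) ≤ n + m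
  n+[2+p]≤n+m = begin
    n + suc (suc p) ≡⟨ +-suc n (suc p) ⟩
    suc n + suc p   ≤⟨ +-monoˡ-≤ (suc p) n<p ⟩
    p + suc p       ≡⟨ +-suc p p ⟩
    suc (p + p)     ≡⟨ n+m≡F ⟨
    n + m           ∎
  1+m≤F : suc m ≤ suc (p + p)
  1+m≤F = subst (suc m ≤_) n+m≡F (+-monoˡ-≤ m 0<n)

mid-complement : ∀ {p n m} → 2 + p ≤ n → n ≤ p + p → n + m ≡ suc (p + p) → 0 < m × m < p
mid-complement {p} {n} {zero} _ n≤2p n+0≡F =
  contradiction (subst (_≤ p + p) (trans (sym (+-identityʳ n)) n+0≡F) n≤2p) (<-irrefl refl)
mid-complement {p} {n} {suc m} 2+p≤n _ n+m≡F = z<s , +-cancelʳ-≤ (suc p) (suc (suc m)) p (begin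
  suc (suc m) + suc p ≡⟨ +-suc (suc m) (suc p) ⟨
  suc m + (2 + p)     ≤⟨ +-monoʳ-≤ (suc m) 2+p≤n ⟩
  suc m + n           ≡⟨ +-comm (suc m) n ⟩
  n + suc m           ≡⟨ n+m≡F ⟩
  suc (p + p)         ≡⟨ +-suc p p ⟨
  p + suc p           ∎)
  where open ≤-Reasoning

Sₚ-symmetric : ∀ {p n m} → n + m ≡ suc (p + p) → ExactlyOne (Sₚ p n) (Sₚ p m)
Sₚ-symmetric {p} {n} {m} n+m≡F with region p n
... | at-0         = inj₁ (0∈ , subst (¬_ ∘ Sₚ p) (sym n+m≡F) F∉Sₚ)
... | low 0<n n<p  = let (2+p≤m , m≤2p) = low-complement 0<n n<p n+m≡F
                     in inj₂ (low∉Sₚ 0<n n<p , middle∈ 2+p≤m m≤2p)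
... | at-p         = inj₁ (p∈ , subst (¬_ ∘ Sₚ p)
                       (sym (+-cancelˡ-≡ p m (suc p) (trans n+m≡F (sym (+-suc p p))))) 1+p∉Sₚ)
... | at-1+p       = inj₂ (1+p∉Sₚ , subst (Sₚ p) (sym (+-cancelˡ-≡ p m p (suc-injective n+m≡F))) p∈)
... | mid l u      = let (0<m , m<p) = mid-complement l u n+m≡F
                     in inj₁ (middle∈ l u , low∉Sₚ 0<m m<p)
... | at-F         = inj₂ (F∉Sₚ , subst (Sₚ p) (sym (+-cancelˡ-≡ n m 0 (trans n+m≡F (sym (+-identityʳ n))))) 0∈)
... | high 2+2p≤n  = contradiction (≤-trans 2+2p≤n (subst (n ≤_) n+m≡F (m≤m+n n m))) (<-irrefl refl ∘ ≤-pred)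

Sₚ-reflective : ∀ {p z} → z < suc p → ExactlyOne (Sₚ p z) (Sₚ p (z + suc p))
Sₚ-reflective {p} {z} z<1+p with region p z
... | at-0         = inj₁ (0∈ , 1+p∉Sₚ)
... | low 0<z z<p  = inj₂ (low∉Sₚ 0<z z<p , middle∈ (+-monoˡ-≤ (suc p) 0<z)
                       (subst (_≤ p + p) (sym (+-suc z p)) (+-monoˡ-≤ p z<p)))
... | at-p         = inj₁ (p∈ , subst (¬_ ∘ Sₚ p) (sym (+-suc p p)) F∉Sₚ)
... | at-1+p       = contradiction z<1+p (<-irrefl refl)
... | mid 2+p≤z _  = contradiction (≤-trans (n≤1+n _) 2+p≤z) (<⇒≱ z<1+p)
... | at-F         = contradiction z<1+p (<⇒≱ (s≤s (s≤s (m≤m+n p p))))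
... | high 2+2p≤z  = contradiction (≤-trans (n≤1+n _) (2+2p≤⇒2+p≤ 2+2p≤z)) (<⇒≱ z<1+p)

Sₚ-semigroup : ∀ p → 2 ≤ p → NumericalSemigroup
Sₚ-semigroup p 2≤p = record
  { _∈S      = Sₚ p
  ; zero∈    = 0∈
  ; +-closed = Sₚ-+-closed 2≤p
  ; cofinite = 2 + (p + p) , λ _ → above∈
  }

Sₚ-gaps : ℕ → List ℕ
Sₚ-gaps p = map suc (upTo (p ∸ 1)) ++ suc p ∷ suc (p + p) ∷ []

∈-lowGaps⇒<p : ∀ {p n} → n ∈ map suc (upTo (p ∸ 1)) → 0 < n × n < p
∈-lowGaps⇒<p {suc p} n∈ with i , i∈ , refl ← ∈-map⁻ suc n∈ = z<s , s≤s (∈-upTo⁻ i∈)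

module _ {p : ℕ} (0<p : 0 < p) where

  Sₚ-gaps-unique : Unique (Sₚ-gaps p)
  Sₚ-gaps-unique = Unique.++⁺ (Unique.map⁺ suc-injective (Unique.upTo⁺ (p ∸ 1)))
    ((<⇒≢ (s<s (m<m+n p 0<p)) ∷ []) ∷ [] ∷ []) disjoint
    where
    disjoint : ∀ {n} → ¬ (n ∈ map suc (upTo (p ∸ 1)) × n ∈ suc p ∷ suc (p + p) ∷ [])
    disjoint (n∈ , here refl)         = <⇒≱ (proj₂ (∈-lowGaps⇒<p n∈)) (n≤1+n p)
    disjoint (n∈ , there (here refl)) = <⇒≱ (proj₂ (∈-lowGaps⇒<p n∈)) (≤-trans (m≤m+n p p) (n≤1+n _))

  Sₚ-gaps-length : length (Sₚ-gaps p) ≡ p + 1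
  Sₚ-gaps-length = begin
    length (map suc (upTo (p ∸ 1)) ++ suc p ∷ suc (p + p) ∷ []) ≡⟨ length-++ (map suc (upTo (p ∸ 1))) ⟩
    length (map suc (upTo (p ∸ 1))) + 2                         ≡⟨ cong (_+ 2) (trans (length-map suc (upTo (p ∸ 1))) (length-upTo (p ∸ 1))) ⟩
    (p ∸ 1) + 2                                                 ≡⟨ +-suc (p ∸ 1) 1 ⟩
    suc (p ∸ 1 + 1)                                             ≡⟨ cong suc (m∸n+n≡m 0<p) ⟩
    suc p                                                       ≡⟨ +-comm 1 p ⟩
    p + 1                                                       ∎
    where open ≡-Reasoning

Sₚ-gaps-complement : ∀ p n → (n ∈ Sₚ-gaps p) ⇔ (¬ Sₚ p n)
Sₚ-gaps-complement p n = mk⇔ gap ∈gaps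
  where
  gap : n ∈ Sₚ-gaps p → ¬ Sₚ p n
  gap n∈ with ∈-++⁻ (map suc (upTo (p ∸ 1))) n∈
  ... | inj₁ n∈low                = uncurry low∉Sₚ (∈-lowGaps⇒<p n∈low)
  ... | inj₂ (here refl)          = 1+p∉Sₚ
  ... | inj₂ (there (here refl))  = F∉Sₚ
  ∈gaps : ¬ Sₚ p n → n ∈ Sₚ-gaps p
  ∈gaps n∉ with region p n
  ... | at-0        = contradiction 0∈ n∉
  ... | low 0<n n<p = ∈-++⁺ˡ (∈lowGaps 0<n n<p)
    where
    ∈lowGaps : ∀ {n} → 0 < n → n < p → n ∈ map suc (upTo (p ∸ 1))
    ∈lowGaps {suc i} _ i<p = ∈-map⁺ suc (∈-upTo⁺ (∸-monoˡ-< i<p (s≤s z≤n)))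
  ... | at-p        = contradiction p∈ n∉
  ... | at-1+p      = ∈-++⁺ʳ (map suc (upTo (p ∸ 1))) (here refl)
  ... | mid l u     = contradiction (middle∈ l u) n∉
  ... | at-F        = ∈-++⁺ʳ (map suc (upTo (p ∸ 1))) (there (here refl))
  ... | high l      = contradiction (above∈ l) n∉

module _ {p : ℕ} (2≤p : 2 ≤ p) where

  Sₚ-genus : HasGenus (Sₚ-semigroup p 2≤p) (p + 1)
  Sₚ-genus = Sₚ-gaps p , Sₚ-gaps-length 0<p , Sₚ-gaps-unique 0<p , Sₚ-gaps-complement p
    where
    0<p : 0 < p
    0<p = <-trans z<s 2≤p

  Sₚ-isSymmetric : Symmetric (Sₚ-semigroup p 2≤p)
  Sₚ-isSymmetric = symmetric⁺ (Sₚ-semigroup p 2≤p) (F∉Sₚ , λ _ → above∈)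
                     (λ n n≤F → Sₚ-symmetric (m+[n∸m]≡n n≤F))

  Sₚ-isReflective : Reflective (Sₚ-semigroup p 2≤p)
  Sₚ-isReflective = p + 1 , Sₚ-genus , m≤n+m 1 p ,
    subst (ReflectivePairs (Sₚ-semigroup p 2≤p)) (+-comm 1 p) (λ _ → Sₚ-reflective)

Sₚ⊆submonoid : ∀ {P p} → IsSubmonoid P → 0 < p → P p → (∀ {n} → 2 + p ≤ n → n ≤ p + p → P n) →
  P (suc (p + (p + p))) → ∀ {n} → Sₚ p n → P n
Sₚ⊆submonoid {P} {p} submonoid 0<p Pp Pmiddle P3p+1 = least
  where
  open IsSubmonoid submonoid
  2+p+k≡p+[2+k] : ∀ p k → 2 + p + k ≡ p + (2 + k)
  2+p+k≡p+[2+k] = solve-∀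
  p+[2+p+k]≡2+2p+k : ∀ p k → p + (2 + p + k) ≡ 2 + (p + p) + k
  p+[2+p+k]≡2+2p+k = solve-∀
  3p+1≡2+2p+k : ∀ k → suc (suc k + (suc k + suc k)) ≡ 2 + (suc k + suc k) + k
  3p+1≡2+2p+k = solve-∀
  -- The run 2p+2, …, 3p+1 is p plus the middle interval, except for 3p+1 itself.
  firstRun : ∀ k → k < p → P (2 + (p + p) + k)
  firstRun k k<p with m≤n⇒m<n∨m≡n k<p
  ... | inj₁ 1+k<p = subst P (p+[2+p+k]≡2+2p+k p k)
                       (∙-closed Pp (Pmiddle (m≤m+n (2 + p) k)
                         (subst (_≤ p + p) (sym (2+p+k≡p+[2+k] p k)) (+-monoʳ-≤ p 1+k<p))))
  ... | inj₂ refl  = subst P (3p+1≡2+2p+k k) P3p+1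
  least : ∀ {n} → Sₚ p n → P n
  least 0∈             = ε∈
  least p∈             = Pp
  least (middle∈ l u)  = Pmiddle l u
  least (above∈ {n} l) = subst P (m+[n∸m]≡n l) (run⇒all≥ submonoid 0<p Pp firstRun (n ∸ (2 + (p + p))))

Sₚ-isSubmonoid : ∀ {p} → 2 ≤ p → IsSubmonoid (Sₚ p)
Sₚ-isSubmonoid 2≤p = record { ε∈ = 0∈ ; ∙-closed = Sₚ-+-closed 2≤p }

gens⊆Sₚ : ∀ {p} → 2 ≤ p → All (Sₚ p) (gens p)
gens⊆Sₚ {1} (s≤s ())
gens⊆Sₚ {2}               _ = p∈ ∷ above∈ (s≤s (s≤s (s≤s (s≤s (s≤s (s≤s z≤n)))))) ∷ []
gens⊆Sₚ {p@(suc (suc (suc q)))} _ =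
  p∈ ∷ All.map⁺ (All.applyUpTo⁺₁ id (suc q) λ {i} i<1+q →
    middle∈ (subst (_≤ p + 2 + i) (+-comm p 2) (m≤m+n (p + 2) i))
            (subst (p + 2 + i ≤_) (p+2+[1+q]≡p+p q) (+-monoʳ-≤ (p + 2) (<⇒≤ i<1+q))))
  where
  p+2+[1+q]≡p+p : ∀ q → 3 + q + 2 + suc q ≡ 3 + q + (3 + q)
  p+2+[1+q]≡p+p = solve-∀

Sₚ⊆⟨gens⟩ : ∀ {p} → 2 ≤ p → ∀ {n} → Sₚ p n → n ∈⟨ gens p ⟩
Sₚ⊆⟨gens⟩ {1} (s≤s ())
Sₚ⊆⟨gens⟩ {2} _ =
  Sₚ⊆submonoid (⟨⟩-isSubmonoid (2 ∷ 7 ∷ [])) z<s 2∈⟨⟩ middle∈⟨⟩ (generator∈⟨⟩ (there (here refl)))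
  where
  open IsSubmonoid (⟨⟩-isSubmonoid (2 ∷ 7 ∷ []))
  2∈⟨⟩ : 2 ∈⟨ 2 ∷ 7 ∷ [] ⟩
  2∈⟨⟩ = generator∈⟨⟩ (here refl)
  middle∈⟨⟩ : ∀ {n} → 4 ≤ n → n ≤ 4 → n ∈⟨ 2 ∷ 7 ∷ [] ⟩
  middle∈⟨⟩ 4≤n n≤4 = subst (_∈⟨ 2 ∷ 7 ∷ [] ⟩) (≤-antisym 4≤n n≤4) (∙-closed 2∈⟨⟩ 2∈⟨⟩)
Sₚ⊆⟨gens⟩ {p@(suc (suc (suc q)))} _ = Sₚ⊆submonoid ⟨A⟩ z<s (generator∈⟨⟩ (here refl)) middle∈⟨⟩ 3p+1∈
  where
  ⟨A⟩ : IsSubmonoid (_∈⟨ gens p ⟩)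
  ⟨A⟩ = ⟨⟩-isSubmonoid (gens p)
  open IsSubmonoid ⟨A⟩
  shifted∈ : ∀ {i} → i < suc q → (2 + p + i) ∈⟨ gens p ⟩
  shifted∈ {i} i<1+q = subst (λ m → (m + i) ∈⟨ gens p ⟩) (+-comm p 2)
                         (generator∈⟨⟩ (there (∈-map⁺ _ (∈-upTo⁺ i<1+q))))
  middle∈⟨⟩ : ∀ {n} → 2 + p ≤ n → n ≤ p + p → n ∈⟨ gens p ⟩
  middle∈⟨⟩ {n} 2+p≤n n≤2p with m≤n⇒m<n∨m≡n n≤2p
  ... | inj₁ n<2p = subst (_∈⟨ gens p ⟩) (m+[n∸m]≡n 2+p≤n)
                      (shifted∈ (subst (n ∸ (2 + p) <_) ([p+p]∸[2+p]≡1+q q) (∸-monoˡ-< n<2p 2+p≤n)))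
    where
    p+p≡[5+q]+[1+q] : ∀ q → 3 + q + (3 + q) ≡ 5 + q + suc q
    p+p≡[5+q]+[1+q] = solve-∀
    [p+p]∸[2+p]≡1+q : ∀ q → (3 + q + (3 + q)) ∸ (5 + q) ≡ suc q
    [p+p]∸[2+p]≡1+q q = trans (cong (_∸ (5 + q)) (p+p≡[5+q]+[1+q] q)) (m+n∸m≡n (5 + q) (suc q))
  ... | inj₂ refl = ∙-closed (generator∈⟨⟩ (here refl)) (generator∈⟨⟩ (here refl))
  3p+1∈ : suc (p + (p + p)) ∈⟨ gens p ⟩
  3p+1∈ = subst (_∈⟨ gens p ⟩) (3p+1≡[2+p]+[2+p+q] q) (∙-closed (shifted∈ z<s) (shifted∈ (n<1+n q)))
    where
    3p+1≡[2+p]+[2+p+q] : ∀ q → 2 + (3 + q) + 0 + (2 + (3 + q) + q) ≡ suc (3 + q + (3 + q + (3 + q)))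
    3p+1≡[2+p]+[2+p+q] = solve-∀

⟨gens⟩⇔Sₚ : ∀ {p} → 2 ≤ p → ∀ n → Sₚ p n ⇔ n ∈⟨ gens p ⟩
⟨gens⟩⇔Sₚ 2≤p n = mk⇔ (Sₚ⊆⟨gens⟩ 2≤p) (⟨⟩-least (Sₚ-isSubmonoid 2≤p) (gens⊆Sₚ 2≤p))

-- Symmetric reflective semigroups of genus p + 1

module SymmetricReflective (S : NumericalSemigroup) {p : ℕ}
  (frobenius : IsFrobenius S (suc (p + p)))
  (symmetric : SymmetricPairs S (suc (p + p)))
  (reflective : ReflectivePairs S (suc p)) where

  open NumericalSemigroup S using () renaming (_∈S to _∈S′)

  p∈S : p ∈S′
  p∈S = exactlyOne-¬ʳ (reflective p ≤-refl) (subst (¬_ ∘ _∈S′) (sym (+-suc p p)) (proj₁ frobenius))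

  1+p∉S : ¬ suc p ∈S′
  1+p∉S = exactlyOne-¬¬ˡ⇒¬ʳ (reflective 0 z<s) (λ 0∉S → 0∉S (zero∈ S))

  reflect : ∀ {z} → z ≤ p → z ∈S′ → (p ∸ z) ∈S′
  reflect {z} z≤p z∈S = subst _∈S′ F∸[z+1+p]≡p∸z
    (exactlyOne-¬ˡ (symmetric (z + suc p) z+1+p≤F)
      (exactlyOne-¬¬ˡ⇒¬ʳ (reflective z (s≤s z≤p)) (λ z∉S → z∉S z∈S)))
    where
    z+1+p≤F : z + suc p ≤ suc (p + p)
    z+1+p≤F = subst (_≤ suc (p + p)) (sym (+-suc z p)) (s≤s (+-monoˡ-≤ p z≤p))
    F∸[z+1+p]≡p∸z : suc (p + p) ∸ (z + suc p) ≡ p ∸ z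
    F∸[z+1+p]≡p∸z = begin
      suc (p + p) ∸ (z + suc p) ≡⟨ cong (suc (p + p) ∸_) (+-suc z p) ⟩
      (p + p) ∸ (z + p)         ≡⟨ cong ((p + p) ∸_) (+-comm z p) ⟩
      (p + p) ∸ (p + z)         ≡⟨ [m+n]∸[m+o]≡n∸o p p z ⟩
      p ∸ z                     ∎
      where open ≡-Reasoning

  differenceClosed : DifferenceClosed (λ n → n ≤ p × n ∈S′)
  differenceClosed {a} {b} a≤b (_ , a∈S) (b≤p , b∈S) =
    ≤-trans (m∸n≤m b a) b≤p ,
    subst _∈S′ p∸[p∸b+a]≡b∸a (reflect p∸b+a≤p (+-closed S (reflect b≤p b∈S) a∈S))
    where
    p∸b+a≤p : p ∸ b + a ≤ p
    p∸b+a≤p = ≤-trans (+-monoʳ-≤ (p ∸ b) a≤b) (≤-reflexive (m∸n+n≡m b≤p))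
    p∸[p∸b+a]≡b∸a : p ∸ (p ∸ b + a) ≡ b ∸ a
    p∸[p∸b+a]≡b∸a = trans (sym (∸-+-assoc p (p ∸ b) a)) (cong (_∸ a) (m∸[m∸n]≡n b≤p))

  module _ (p-prime : Prime p) where

    low∉S : ∀ {n} → 0 < n → n < p → ¬ n ∈S′
    low∉S 0<n n<p n∈S = 1+p∉S (1∈⇒all S 1∈S (suc p))
      where
      1∈S : 1 ∈S′
      1∈S = proj₂ (prime⇒1∈ differenceClosed p-prime (≤-refl , p∈S) 0<n n<p (<⇒≤ n<p , n∈S))

    mid∈S : ∀ {n} → 2 + p ≤ n → n ≤ p + p → n ∈S′
    mid∈S {n} 2+p≤n n≤2p =
      subst _∈S′ z+1+p≡n (exactlyOne-¬ˡ (reflective z (<-trans z<p (n<1+n p))) (low∉S 0<z z<p))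
      where
      z : ℕ
      z = n ∸ suc p
      z+1+p≡n : z + suc p ≡ n
      z+1+p≡n = m∸n+n≡m (≤-trans (n≤1+n _) 2+p≤n)
      0<z : 0 < z
      0<z = m<n⇒0<n∸m 2+p≤n
      z<p : z < p
      z<p = +-cancelʳ-≤ p (suc z) p (subst (_≤ p + p) (trans (sym z+1+p≡n) (+-suc z p)) n≤2p)

    ⇔Sₚ : ∀ n → n ∈S′ ⇔ Sₚ p n
    ⇔Sₚ n = mk⇔ (toSₚ (region p n)) fromSₚ
      where
      toSₚ : ∀ {n} → Region p n → n ∈S′ → Sₚ p n
      toSₚ at-0          _   = 0∈
      toSₚ (low 0<n n<p) n∈S = contradiction n∈S (low∉S 0<n n<p)
      toSₚ at-p          _   = p∈
      toSₚ at-1+p        n∈S = contradiction n∈S 1+p∉S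
      toSₚ (mid l u)     _   = middle∈ l u
      toSₚ at-F          n∈S = contradiction n∈S (proj₁ frobenius)
      toSₚ (high l)      _   = above∈ l
      fromSₚ : ∀ {n} → Sₚ p n → n ∈S′
      fromSₚ 0∈            = zero∈ S
      fromSₚ p∈            = p∈S
      fromSₚ (middle∈ l u) = mid∈S l u
      fromSₚ (above∈ l)    = proj₂ frobenius _ l

symmetric-reflective⇒Sₚ : ∀ {p} → Prime p → ∀ S → HasGenus S (suc p) → Symmetric S →
  ReflectivePairs S (suc p) → ∀ n → _∈S S n ⇔ Sₚ p n
symmetric-reflective⇒Sₚ p-prime S genus sym reflective
  with frob , pairs ← symmetric⁻ S sym
  with refl ← symmetric-reflective⇒frobenius S genus reflective frob pairs
  = SymmetricReflective.⇔Sₚ S frob pairs reflective p-prime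

corollary5p4 : (p : ℕ) → Prime p →
    (Σ[ S ∈ NumericalSemigroup ]
       (HasGenus S (p + 1) × Symmetric S × Reflective S ×
        (∀ n → _∈S S n ⇔ n ∈⟨ gens p ⟩)))
    × (∀ (S : NumericalSemigroup) → HasGenus S (p + 1) → Symmetric S → Reflective S →
        ∀ n → _∈S S n ⇔ n ∈⟨ gens p ⟩)
corollary5p4 p p-prime = existence , uniqueness
  where
  2≤p : 2 ≤ p
  2≤p = nonTrivial⇒n>1 p {{prime⇒nonTrivial p-prime}}
  existence : Σ[ S ∈ NumericalSemigroup ] (HasGenus S (p + 1) × Symmetric S × Reflective S ×
                (∀ n → _∈S S n ⇔ n ∈⟨ gens p ⟩))
  existence = Sₚ-semigroup p 2≤p , Sₚ-genus 2≤p , Sₚ-isSymmetric 2≤p , Sₚ-isReflective 2≤p , ⟨gens⟩⇔Sₚ 2≤p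
  uniqueness : ∀ S → HasGenus S (p + 1) → Symmetric S → Reflective S → ∀ n → _∈S S n ⇔ n ∈⟨ gens p ⟩
  uniqueness S genus sym reflective n =
    ⇔.trans (symmetric-reflective⇒Sₚ p-prime S genus′ sym (reflective⁻ S genus′ reflective) n)
            (⟨gens⟩⇔Sₚ 2≤p n)
    where
    genus′ : HasGenus S (suc p)
    genus′ = subst (HasGenus S) (+-comm p 1) genus
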